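{- Let $m\ge 2$ and let $G$ be a bipartite graph with parts $A$ and $B$, $|A|=|B|=2m$, and minimum degree at least $m-1$. If $A_1\subseteq A$ satisfies $|N(A_1)|<|A_1|$, then $(|A_1|,|N(A_1)|)$ is one of $(m,m-1)$, $(m+1,m-1)$, $(m+1,m)$; moreover, setting $A_2=A\setminus A_1$, $B_1=N(A_1)$ and $B_2=B\setminus B_1$, the graph $G[A_1,B_2]$ has no edges, and respectively: (1) if $(|A_1|,|N(A_1)|)=(m,m-1)$ then $G[A_1,B_1]\cong K_{m,m-1}$; (2) if $(|A_1|,|N(A_1)|)=(m+1,m-1)$ then $G[A_1,B_1]\cong K_{m+1,m-1}$ and $G[A_2,B_2]\cong K_{m-1,m+1}$; (3) if $(|A_1|,|N(A_1)|)=(m+1,m)$ then $G[A_2,B_2]\cong K_{m-1,m}$.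
   Context: $N(S)$ denotes the set of vertices adjacent to some vertex of $S$; $G[X,Y]$ denotes the bipartite subgraph of $G$ consisting of the vertices $X\cup Y$ and the edges of $G$ between $X$ and $Y$. -}

module Defs where

open import Data.Nat using (ℕ; _≤_)
open import Data.Bool using (Bool; true; false; _∧_)
open import Data.Fin using (Fin)
open import Data.Fin.Subset using (Subset; _∈_; ∣_∣)
open import Data.List using (allFin)
open import Data.Bool.ListAction using (any)
open import Data.Vec using (tabulate; lookup)
open import Data.Product using (_×_)
open import Relation.Binary.PropositionalEquality using (_≡_)

-- A bipartite graph with parts A = Fin n and B = Fin n, given by its
-- (decidable) adjacency: adj a b ≡ true iff a ∈ A is adjacent to b ∈ B.
BipGraph : ℕ → Set
BipGraph n = Fin n → Fin n → Bool

degA : ∀ {n} → BipGraph n → Fin n → ℕ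
degA G a = ∣ tabulate (λ b → G a b) ∣

degB : ∀ {n} → BipGraph n → Fin n → ℕ
degB G b = ∣ tabulate (λ a → G a b) ∣

MinDegAtLeast : ∀ {n} → BipGraph n → ℕ → Set
MinDegAtLeast G d = (∀ a → d ≤ degA G a) × (∀ b → d ≤ degB G b)

N : ∀ {n} → BipGraph n → Subset n → Subset n
N {n} G S = tabulate (λ b → any (λ a → lookup S a ∧ G a b) (allFin n))

NoEdges : ∀ {n} → BipGraph n → Subset n → Subset n → Set
NoEdges G X Y = ∀ a b → a ∈ X → b ∈ Y → G a b ≡ false

-- G[X,Y] ≅ K_{p,q} (as bipartite graphs with sides X, Y):
-- |X| = p, |Y| = q, and every a ∈ X is adjacent to every b ∈ Y.
IsoK : ∀ {n} → BipGraph n → Subset n → Subset n → ℕ → ℕ → Set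
IsoK G X Y p q = ∣ X ∣ ≡ p × ∣ Y ∣ ≡ q × (∀ a b → a ∈ X → b ∈ Y → G a b ≡ true)

{-# OPTIONS --safe #-}
-- Every neighbour of a vertex of A₁ lies in B₁ = N(A₁), and every neighbour of a
-- vertex of B₂ = B ∖ B₁ lies in A₂ = A ∖ A₁ (there are no A₁–B₂ edges). A₁ and B₂
-- are nonempty, so the degree bound gives m − 1 ≤ |B₁| and
-- m − 1 ≤ |A₂| = 2m − |A₁|; with |B₁| < |A₁| only the three listed size pairs
-- remain. Whenever a side of size m − 1 occurs, every vertex facing it has at
-- least m − 1 neighbours, all inside that side, hence is adjacent to all of it.
module Submission where

open import Defs
open import Data.Nat using (ℕ; _≤_; _<_; _*_; _∸_; _+_; suc; s≤s; z≤n)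
open import Data.Nat.Properties
  using (≤-trans; ≤-reflexive; ≤-antisym; <⇒≱; <⇒≢; ≤∧≢⇒<; ≤-pred; _≟_;
         +-monoʳ-≤; +-cancelʳ-≤; m+[n∸m]≡n; m+n∸m≡n; m<n⇒0<n∸m)
open import Data.Nat.Tactic.RingSolver using (solve-∀)
open import Data.Fin using (Fin)
open import Data.Fin.Subset using (Subset; ∁; ∣_∣; _∈_; _⊆_; Nonempty)
open import Data.Fin.Subset.Properties
  using (_∈?_; nonempty?; Empty-unique; ∣⊥∣≡0; p⊂q⇒∣p∣<∣q∣; p⊆q⇒∣p∣≤∣q∣;
         ∣∁p∣≡n∸∣p∣; ∣p∣≤n; x∈∁p⇒x∉p; x∉p⇒x∈∁p)
open import Data.Bool using (Bool; true; false; _∧_)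
open import Data.Bool.Properties using (T-≡)
open import Data.Vec using (tabulate)
open import Data.Vec.Properties using ([]=⇒lookup; lookup⇒[]=; lookup∘tabulate)
open import Data.List.Membership.Propositional using (lose)
open import Data.List.Membership.Propositional.Properties using (∈-allFin)
open import Data.List.Relation.Unary.Any.Properties using (any⁺)
open import Data.Product using (_×_; _,_)
open import Data.Sum using (_⊎_; inj₁; inj₂)
open import Data.Empty using (⊥-elim)
open import Function.Base using (_∘_)
open import Function.Bundles using (Equivalence)
open import Relation.Nullary using (yes; no)
open import Relation.Binary.PropositionalEquality
  using (_≡_; refl; sym; trans; cong; cong₂; subst; module ≡-Reasoning)

open Equivalence using (to; from)

private
  variable
    n d : ℕ

∈-tabulate⁺ : {f : Fin n → Bool} {x : Fin n} → f x ≡ true → x ∈ tabulate f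
∈-tabulate⁺ {f = f} {x} fx = lookup⇒[]= x (tabulate f) (trans (lookup∘tabulate f x) fx)

∈-tabulate⁻ : {f : Fin n → Bool} {x : Fin n} → x ∈ tabulate f → f x ≡ true
∈-tabulate⁻ {f = f} {x} x∈ = trans (sym (lookup∘tabulate f x)) ([]=⇒lookup x∈)

p⊆q∧∣q∣≤∣p∣⇒q⊆p : {p q : Subset n} → p ⊆ q → ∣ q ∣ ≤ ∣ p ∣ → q ⊆ p
p⊆q∧∣q∣≤∣p∣⇒q⊆p {p = p} p⊆q ∣q∣≤∣p∣ {x} x∈q with x ∈? p
... | yes x∈p = x∈p
... | no  x∉p = ⊥-elim (<⇒≱ (p⊂q⇒∣p∣<∣q∣ (p⊆q , x , x∈q , x∉p)) ∣q∣≤∣p∣)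

0<∣p∣⇒Nonempty : {p : Subset n} → 0 < ∣ p ∣ → Nonempty p
0<∣p∣⇒Nonempty {n} {p} 0<∣p∣ with nonempty? p
... | yes ne = ne
... | no  ¬ne = ⊥-elim (<⇒≢ 0<∣p∣ (sym (trans (cong ∣_∣ (Empty-unique ¬ne)) (∣⊥∣≡0 n))))

∣p∣+c≡n⇒∣∁p∣≡c : ∀ {n} {p : Subset n} {a c} → ∣ p ∣ ≡ a → a + c ≡ n → ∣ ∁ p ∣ ≡ c
∣p∣+c≡n⇒∣∁p∣≡c {n} {p} {a} {c} ∣p∣≡a a+c≡n = begin
  ∣ ∁ p ∣     ≡⟨ ∣∁p∣≡n∸∣p∣ p ⟩
  n ∸ ∣ p ∣   ≡⟨ cong₂ _∸_ (sym a+c≡n) ∣p∣≡a ⟩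
  a + c ∸ a   ≡⟨ m+n∸m≡n a c ⟩
  c           ∎
  where open ≡-Reasoning

∣p∣<∣q∣⇒Nonempty-q : {p q : Subset n} → ∣ p ∣ < ∣ q ∣ → Nonempty q
∣p∣<∣q∣⇒Nonempty-q ∣p∣<∣q∣ = 0<∣p∣⇒Nonempty (≤-trans (s≤s z≤n) ∣p∣<∣q∣)

∣p∣<n⇒Nonempty-∁p : {p : Subset n} → ∣ p ∣ < n → Nonempty (∁ p)
∣p∣<n⇒Nonempty-∁p {p = p} ∣p∣<n =
  0<∣p∣⇒Nonempty (subst (0 <_) (sym (∣∁p∣≡n∸∣p∣ p)) (m<n⇒0<n∸m ∣p∣<n))

≤∣∁p∣⇒∣p∣+d≤n : ∀ {n d} {p : Subset n} → d ≤ ∣ ∁ p ∣ → ∣ p ∣ + d ≤ n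
≤∣∁p∣⇒∣p∣+d≤n {p = p} d≤∣∁p∣ = ≤-trans
  (+-monoʳ-≤ ∣ p ∣ (subst (_ ≤_) (∣∁p∣≡n∸∣p∣ p) d≤∣∁p∣)) (≤-reflexive (m+[n∸m]≡n (∣p∣≤n p)))

module _ (G : BipGraph n) where

  nbrA : Fin n → Subset n
  nbrA x = tabulate (G x)

  nbrB : Fin n → Subset n
  nbrB y = tabulate (λ x → G x y)

  ∈-N : ∀ {A x y} → x ∈ A → G x y ≡ true → y ∈ N G A
  ∈-N {x = x} x∈A xy = ∈-tabulate⁺ (to T-≡ (any⁺ _ (lose (∈-allFin x)
    (from T-≡ (cong₂ _∧_ ([]=⇒lookup x∈A) xy)))))

  nbrA⊆N : ∀ {A x} → x ∈ A → nbrA x ⊆ N G A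
  nbrA⊆N x∈A y∈ = ∈-N x∈A (∈-tabulate⁻ y∈)

  N-∁-noEdges : ∀ A → NoEdges G A (∁ (N G A))
  N-∁-noEdges A x y x∈A y∉N with G x y in xy
  ... | false = refl
  ... | true  = ⊥-elim (x∈∁p⇒x∉p y∉N (∈-N x∈A xy))

  nbrB⊆∁ : ∀ {A y} → y ∈ ∁ (N G A) → nbrB y ⊆ ∁ A
  nbrB⊆∁ y∉N x∈ = x∉p⇒x∈∁p (λ x∈A → x∈∁p⇒x∉p y∉N (∈-N x∈A (∈-tabulate⁻ x∈)))

  module _ (δ : ∀ x → d ≤ degA G x) (A : Subset n) where

    minDeg⇒≤∣N∣ : Nonempty A → d ≤ ∣ N G A ∣
    minDeg⇒≤∣N∣ (x , x∈A) = ≤-trans (δ x) (p⊆q⇒∣p∣≤∣q∣ (nbrA⊆N x∈A))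

    ∣N∣≤minDeg⇒complete : ∣ N G A ∣ ≤ d → ∀ x y → x ∈ A → y ∈ N G A → G x y ≡ true
    ∣N∣≤minDeg⇒complete ∣N∣≤d x y x∈A =
      ∈-tabulate⁻ ∘ p⊆q∧∣q∣≤∣p∣⇒q⊆p (nbrA⊆N x∈A) (≤-trans ∣N∣≤d (δ x))

  module _ (δ : ∀ y → d ≤ degB G y) (A : Subset n) where

    minDeg⇒≤∣∁∣ : Nonempty (∁ (N G A)) → d ≤ ∣ ∁ A ∣
    minDeg⇒≤∣∁∣ (y , y∉N) = ≤-trans (δ y) (p⊆q⇒∣p∣≤∣q∣ (nbrB⊆∁ {A} y∉N))

    ∣∁∣≤minDeg⇒complete : ∣ ∁ A ∣ ≤ d → ∀ x y → x ∈ ∁ A → y ∈ ∁ (N G A) → G x y ≡ true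
    ∣∁∣≤minDeg⇒complete ∣∁A∣≤d x y x∉A y∉N = ∈-tabulate⁻ {f = λ a → G a y}
      (p⊆q∧∣q∣≤∣p∣⇒q⊆p (nbrB⊆∁ y∉N) (≤-trans ∣∁A∣≤d (δ y)) x∉A)

k≤b<a≤2+k : ∀ k {a b} → k ≤ b → b < a → a ≤ 2 + k →
            (a ≡ 1 + k × b ≡ k) ⊎ (a ≡ 2 + k × b ≡ k) ⊎ (a ≡ 2 + k × b ≡ 1 + k)
k≤b<a≤2+k k {a} {b} k≤b b<a a≤2+k with b ≟ k | a ≟ suc k
... | yes refl | yes refl = inj₁ (refl , refl)
... | yes refl | no  a≢1+k = inj₂ (inj₁ (≤-antisym a≤2+k (≤∧≢⇒< b<a (a≢1+k ∘ sym)) , refl))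
... | no  b≢k  | _ = inj₂ (inj₂ (≤-antisym a≤2+k (≤-trans (s≤s k<b) b<a) , b≡1+k))
  where
  k<b : k < b
  k<b = ≤∧≢⇒< k≤b (b≢k ∘ sym)
  b≡1+k : b ≡ 1 + k
  b≡1+k = ≤-antisym (≤-pred (≤-trans b<a a≤2+k)) k<b

2+k+k≡2*[1+k] : ∀ k → 2 + k + k ≡ 2 * suc k
2+k+k≡2*[1+k] = solve-∀

k+[2+k]≡2*[1+k] : ∀ k → k + (2 + k) ≡ 2 * suc k
k+[2+k]≡2*[1+k] = solve-∀

1+k+[1+k]≡2*[1+k] : ∀ k → suc k + suc k ≡ 2 * suc k
1+k+[1+k]≡2*[1+k] = solve-∀

lemma17 : (m : ℕ) → 2 ≤ m → (G : BipGraph (2 * m)) → MinDegAtLeast G (m ∸ 1) →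
          (A₁ : Subset (2 * m)) → ∣ N G A₁ ∣ < ∣ A₁ ∣ →
          ((∣ A₁ ∣ ≡ m × ∣ N G A₁ ∣ ≡ m ∸ 1
              × IsoK G A₁ (N G A₁) m (m ∸ 1))
           ⊎ (∣ A₁ ∣ ≡ suc m × ∣ N G A₁ ∣ ≡ m ∸ 1
              × IsoK G A₁ (N G A₁) (suc m) (m ∸ 1)
              × IsoK G (∁ A₁) (∁ (N G A₁)) (m ∸ 1) (suc m))
           ⊎ (∣ A₁ ∣ ≡ suc m × ∣ N G A₁ ∣ ≡ m
              × IsoK G (∁ A₁) (∁ (N G A₁)) (m ∸ 1) m))
          × NoEdges G A₁ (∁ (N G A₁))
lemma17 (suc k) _ G (δA , δB) A₁ ∣B₁∣<∣A₁∣ =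
  shape (k≤b<a≤2+k k k≤∣B₁∣ ∣B₁∣<∣A₁∣ ∣A₁∣≤2+k) , N-∁-noEdges G A₁
  where
  B₁ : Subset (2 * suc k)
  B₁ = N G A₁

  k≤∣B₁∣ : k ≤ ∣ B₁ ∣
  k≤∣B₁∣ = minDeg⇒≤∣N∣ G δA A₁ (∣p∣<∣q∣⇒Nonempty-q {p = B₁} {A₁} ∣B₁∣<∣A₁∣)

  k≤∣∁A₁∣ : k ≤ ∣ ∁ A₁ ∣
  k≤∣∁A₁∣ = minDeg⇒≤∣∁∣ G δB A₁
    (∣p∣<n⇒Nonempty-∁p {p = B₁} (≤-trans ∣B₁∣<∣A₁∣ (∣p∣≤n A₁)))

  ∣A₁∣≤2+k : ∣ A₁ ∣ ≤ 2 + k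
  ∣A₁∣≤2+k = +-cancelʳ-≤ k _ _ (≤-trans
    (≤∣∁p∣⇒∣p∣+d≤n {p = A₁} k≤∣∁A₁∣) (≤-reflexive (sym (2+k+k≡2*[1+k] k))))

  ∣∁A₁∣≡k : ∣ A₁ ∣ ≡ 2 + k → ∣ ∁ A₁ ∣ ≡ k
  ∣∁A₁∣≡k ∣A₁∣≡2+k = ∣p∣+c≡n⇒∣∁p∣≡c {p = A₁} ∣A₁∣≡2+k (2+k+k≡2*[1+k] k)

  shape : (∣ A₁ ∣ ≡ 1 + k × ∣ B₁ ∣ ≡ k) ⊎ (∣ A₁ ∣ ≡ 2 + k × ∣ B₁ ∣ ≡ k)
            ⊎ (∣ A₁ ∣ ≡ 2 + k × ∣ B₁ ∣ ≡ 1 + k) →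
          (∣ A₁ ∣ ≡ 1 + k × ∣ B₁ ∣ ≡ k × IsoK G A₁ B₁ (1 + k) k)
            ⊎ (∣ A₁ ∣ ≡ 2 + k × ∣ B₁ ∣ ≡ k
                × IsoK G A₁ B₁ (2 + k) k × IsoK G (∁ A₁) (∁ B₁) k (2 + k))
            ⊎ (∣ A₁ ∣ ≡ 2 + k × ∣ B₁ ∣ ≡ 1 + k × IsoK G (∁ A₁) (∁ B₁) k (1 + k))
  shape (inj₁ (a≡ , b≡)) =
    inj₁ (a≡ , b≡ , a≡ , b≡ , ∣N∣≤minDeg⇒complete G δA A₁ (≤-reflexive b≡))
  shape (inj₂ (inj₁ (a≡ , b≡))) =
    inj₂ (inj₁ (a≡ , b≡ , (a≡ , b≡ , ∣N∣≤minDeg⇒complete G δA A₁ (≤-reflexive b≡)) ,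
      (∣∁A₁∣≡k a≡ , ∣p∣+c≡n⇒∣∁p∣≡c {p = B₁} b≡ (k+[2+k]≡2*[1+k] k) ,
       ∣∁∣≤minDeg⇒complete G δB A₁ (≤-reflexive (∣∁A₁∣≡k a≡)))))
  shape (inj₂ (inj₂ (a≡ , b≡))) =
    inj₂ (inj₂ (a≡ , b≡ ,
      (∣∁A₁∣≡k a≡ , ∣p∣+c≡n⇒∣∁p∣≡c {p = B₁} b≡ (1+k+[1+k]≡2*[1+k] k) ,
       ∣∁∣≤minDeg⇒complete G δB A₁ (≤-reflexive (∣∁A₁∣≡k a≡)))))
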